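{- Let $\mathcal{M}$ be a regular matroid on $E$ represented by a totally unimodular real matrix $M$, and $\Lambda=\ker(M)\cap\mathbb{Z}^E$. Every element of $\mathcal{SC}(\mathcal{M})$ is of the form $(\mathcal{N}_\mu,D_\mu)$ for some $\mu\in\Lambda$.
   Context: For $\mu\in\Lambda$, $\mathcal{N}_\mu$ is the sub-matroid of $\mathcal{M}$ with base set $\operatorname{supp}(\mu)=\{e:\mu_e\ne0\}$ and $D_\mu(e)=\operatorname{sgn}(\mu_e)$. An orientation $D:E'\to\{\pm1\}$ of a sub-matroid with base set $E'\subseteq E$ is strongly connected if for every $e\in E'$ there is $z_e\in(\mathbb{Z}_{\ge0})^{E'}$ with $e+z_e\in\ker(M_{E'}^D)\cap\mathbb{Z}^{E'}$, where $M_{E'}^D$ has columns $D(e)c_e$, $e\in E'$ ($c_e$ the columns of $M$). $\mathcal{SC}(\mathcal{M})$ is the set of pairs $(\mathcal{N},D)$ of a sub-matroid $\mathcal{N}$ with a strongly connected orientation $D$. -}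

module Defs where

open import Data.Nat using (ℕ; zero; suc)
open import Data.Integer using (ℤ; +_; -_; _+_; _*_; sign; _◃_)
open import Data.Sign using (Sign)
open import Data.Fin using (Fin; zero; suc; punchIn; _≟_)
open import Data.Bool using (Bool; true; false; if_then_else_)
open import Data.Product using (Σ; _×_; ∃)
open import Data.Sum using (_⊎_)
open import Function.Definitions using (Injective)
open import Relation.Binary.PropositionalEquality using (_≡_; _≢_)
open import Relation.Nullary using (¬_)
open import Relation.Nullary.Decidable using (⌊_⌋)
open import Function.Bundles using (_⇔_)

-- Real m×n matrices with rows indexed by Fin m and columns (the ground set E = Fin n).
-- A totally unimodular real matrix has all entries in {-1,0,1}, hence we take ℤ entries.
Matrix : ℕ → ℕ → Set
Matrix m n = Fin m → Fin n → ℤ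

∑ : {n : ℕ} → (Fin n → ℤ) → ℤ
∑ {zero}  f = + 0
∑ {suc n} f = f zero + ∑ (λ i → f (suc i))

altSign : {n : ℕ} → Fin n → ℤ
altSign zero    = + 1
altSign (suc j) = - altSign j

det : {k : ℕ} → Matrix k k → ℤ
det {zero}  A = + 1
det {suc k} A = ∑ (λ j → altSign j * A zero j * det (λ i l → A (suc i) (punchIn j l)))

TotallyUnimodular : {m n : ℕ} → Matrix m n → Set
TotallyUnimodular {m} {n} M =
  (k : ℕ) (r : Fin k → Fin m) (c : Fin k → Fin n) →
  Injective _≡_ _≡_ r → Injective _≡_ _≡_ c →
  let d = det (λ i j → M (r i) (c j)) in
  (d ≡ - (+ 1)) ⊎ (d ≡ + 0) ⊎ (d ≡ + 1)

InLattice : {m n : ℕ} → Matrix m n → (Fin n → ℤ) → Set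
InLattice M μ = ∀ i → ∑ (λ f → M i f * μ f) ≡ + 0

signℤ : Sign → ℤ
signℤ s = s ◃ 1

-- A sub-matroid is given by its base set E' ⊆ E (characteristic function S),
-- an orientation D : E' → {±1} is given by a function on E of which only
-- the values on E' matter.
-- Strong connectivity of (S , D): for every e ∈ E' there is z ∈ (ℤ≥0)^{E'}
-- (z vanishing off E') such that e + z ∈ ker(M_{E'}^D), where M_{E'}^D
-- has columns D(f) c_f for f ∈ E'.
StronglyConnected : {m n : ℕ} → Matrix m n → (Fin n → Bool) → (Fin n → Sign) → Set
StronglyConnected {m} {n} M S D =
  (e : Fin n) → S e ≡ true →
  Σ (Fin n → ℕ) λ z →
    (∀ f → S f ≡ false → z f ≡ 0) ×
    (∀ i → ∑ (λ f → if S f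
                     then signℤ (D f) * M i f * (+ ((if ⌊ e ≟ f ⌋ then 1 else 0) Data.Nat.+ z f))
                     else + 0) ≡ + 0)

-- (S , D) equals (N_μ , D_μ): S = supp μ, and D agrees with sgn μ on supp μ
IsInducedBy : {n : ℕ} → (Fin n → ℤ) → (Fin n → Bool) → (Fin n → Sign) → Set
IsInducedBy μ S D =
  (∀ e → (S e ≡ true) ⇔ (μ e ≢ + 0)) ×
  (∀ e → S e ≡ true → D e ≡ sign (μ e))

{-# OPTIONS --safe #-}
-- For each e in the base set E', strong connectivity provides a nonnegative integer
-- vector e + z_e in the kernel of the oriented matrix M^D_{E'}.  Their sum over e ∈ E'
-- is still in that kernel and is strictly positive on E'; multiplying its entries by
-- the orientation D turns it into a vector μ ∈ ker(M) ∩ ℤ^E with support E' and sign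
-- pattern D.
module Submission where

open import Defs
open import Data.Nat using (ℕ; zero; suc; _≤_; s≤s; z≤n) renaming (_+_ to _+ℕ_)
import Data.Nat.Properties as ℕ
open import Data.Integer using (ℤ; +_; _+_; _*_; sign)
import Data.Integer.Properties as ℤ
open import Algebra.Properties.CommutativeMonoid.Sum ℤ.+-0-commutativeMonoid
  using (sum; sum-cong-≗; sum-replicate-zero; ∑-comm)
open import Algebra.Properties.Semiring.Sum ℤ.+-*-semiring using (*-distribˡ-sum)
open import Algebra.Properties.CommutativeMonoid.Sum ℕ.+-0-commutativeMonoid
  using () renaming (sum to sumℕ)
open import Data.Sign using (Sign)
open import Data.Empty using (⊥-elim)
open import Data.Fin using (Fin; zero; suc; _≟_)
open import Data.Bool using (Bool; true; false; if_then_else_)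
open import Data.Product using (Σ; _×_; _,_; proj₁; proj₂)
open import Function.Base using (_∘_)
open import Function.Bundles using (mk⇔)
open import Relation.Binary.PropositionalEquality
open import Relation.Nullary using (yes; no)
open import Relation.Nullary.Decidable using (⌊_⌋)

∑≡sum : ∀ {n} (f : Fin n → ℤ) → ∑ f ≡ sum f
∑≡sum {zero}  f = refl
∑≡sum {suc n} f = cong (λ t → f zero + t) (∑≡sum (f ∘ suc))

∑-cong : ∀ {n} {f g : Fin n → ℤ} → (∀ i → f i ≡ g i) → ∑ f ≡ ∑ g
∑-cong {f = f} {g} f≗g = trans (∑≡sum f) (trans (sum-cong-≗ f≗g) (sym (∑≡sum g)))

∑-zero : ∀ n → ∑ {n} (λ _ → + 0) ≡ + 0
∑-zero n = trans (∑≡sum {n} (λ _ → + 0)) (sum-replicate-zero n)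

∑∑≡sumsum : ∀ {m n} (g : Fin m → Fin n → ℤ) → ∑ (λ i → ∑ (g i)) ≡ sum (λ i → sum (g i))
∑∑≡sumsum g = trans (∑≡sum (λ i → ∑ (g i))) (sum-cong-≗ (∑≡sum ∘ g))

∑-swap : ∀ {m n} (g : Fin m → Fin n → ℤ) →
         ∑ (λ i → ∑ (λ j → g i j)) ≡ ∑ (λ j → ∑ (λ i → g i j))
∑-swap g = trans (∑∑≡sumsum g) (trans (∑-comm g) (sym (∑∑≡sumsum (λ j i → g i j))))

*-distribˡ-∑ : ∀ {n} (c : ℤ) (f : Fin n → ℤ) → c * ∑ f ≡ ∑ (λ i → c * f i)
*-distribˡ-∑ c f =
  trans (cong (c *_) (∑≡sum f)) (trans (*-distribˡ-sum c f) (sym (∑≡sum (λ i → c * f i))))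

+-sumℕ : ∀ {n} (g : Fin n → ℕ) → + sumℕ g ≡ ∑ (λ i → + g i)
+-sumℕ {zero}  g = refl
+-sumℕ {suc n} g = cong (λ t → + g zero + t) (+-sumℕ (g ∘ suc))

≤-sumℕ : ∀ {n} (g : Fin n → ℕ) (j : Fin n) → g j ≤ sumℕ g
≤-sumℕ g zero    = ℕ.m≤m+n _ _
≤-sumℕ g (suc j) = ℕ.≤-trans (≤-sumℕ (g ∘ suc) j) (ℕ.m≤n+m _ _)

module Kernel {m n : ℕ} (M : Matrix m n) where

  kernel-zero : InLattice M (λ _ → + 0)
  kernel-zero i = trans (∑-cong (λ f → ℤ.*-zeroʳ (M i f))) (∑-zero n)

  kernel-∑ : ∀ {k} (v : Fin k → Fin n → ℤ) → (∀ e → InLattice M (v e)) →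
             InLattice M (λ f → ∑ (λ e → v e f))
  kernel-∑ {k} v v∈ker i = begin
    ∑ (λ f → M i f * ∑ (λ e → v e f))  ≡⟨ ∑-cong (λ f → *-distribˡ-∑ (M i f) (λ e → v e f)) ⟩
    ∑ (λ f → ∑ (λ e → M i f * v e f))  ≡⟨ ∑-swap (λ f e → M i f * v e f) ⟩
    ∑ (λ e → ∑ (λ f → M i f * v e f))  ≡⟨ ∑-cong (λ e → v∈ker e i) ⟩
    ∑ {k} (λ _ → + 0)                   ≡⟨ ∑-zero k ⟩
    + 0                                 ∎
    where open ≡-Reasoning

  kernel-scaleColumns : (c x : Fin n → ℤ) → InLattice (λ i f → c f * M i f) x →
                        InLattice M (λ f → c f * x f)
  kernel-scaleColumns c x x∈ker i = trans (∑-cong reassoc) (x∈ker i)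
    where
    reassoc : ∀ f → M i f * (c f * x f) ≡ c f * M i f * x f
    reassoc f = begin
      M i f * (c f * x f)  ≡⟨ sym (ℤ.*-assoc (M i f) (c f) (x f)) ⟩
      M i f * c f * x f    ≡⟨ cong (_* x f) (ℤ.*-comm (M i f) (c f)) ⟩
      c f * M i f * x f    ∎
      where open ≡-Reasoning

open Kernel

orientation : ∀ {n} → (Fin n → Bool) → (Fin n → Sign) → Fin n → ℤ
orientation S D f = if S f then signℤ (D f) else + 0

sign-positive : (s : Sign) {x : ℕ} → 1 ≤ x → sign (signℤ s * + x) ≡ s
sign-positive Sign.- (s≤s _) = refl
sign-positive Sign.+ (s≤s _) = refl

signℤ-*-positive≢0 : (s : Sign) {x : ℕ} → 1 ≤ x → signℤ s * + x ≢ + 0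
signℤ-*-positive≢0 Sign.- (s≤s _) ()
signℤ-*-positive≢0 Sign.+ (s≤s _) ()

orientation-isInducedBy : ∀ {n} (S : Fin n → Bool) (D : Fin n → Sign) (x : Fin n → ℕ) →
  (∀ f → S f ≡ true → 1 ≤ x f) → IsInducedBy (λ f → orientation S D f * + x f) S D
orientation-isInducedBy S D x x>0 = (λ f → mk⇔ (supported f) (inSupport f)) , signed
  where
  supported : ∀ f → S f ≡ true → orientation S D f * + x f ≢ + 0
  supported f Sf rewrite Sf = signℤ-*-positive≢0 (D f) (x>0 f Sf)

  inSupport : ∀ f → orientation S D f * + x f ≢ + 0 → S f ≡ true
  inSupport f μf≢0 with S f
  ... | true  = refl
  ... | false = ⊥-elim (μf≢0 refl)

  signed : ∀ f → S f ≡ true → D f ≡ sign (orientation S D f * + x f)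
  signed f Sf rewrite Sf = sym (sign-positive (D f) (x>0 f Sf))

module _ {m n : ℕ} (M : Matrix m n) (S : Fin n → Bool) (D : Fin n → Sign) where

  -- M^D_{E'}, padded with zero columns outside the base set.
  oriented : Matrix m n
  oriented i f = orientation S D f * M i f

  Circulation : (Fin n → ℕ) → Set
  Circulation w = InLattice oriented (λ f → + w f)

  δ : Fin n → Fin n → ℕ
  δ e f = if ⌊ e ≟ f ⌋ then 1 else 0

  δ-diag : ∀ e → 1 ≤ δ e e
  δ-diag e with e ≟ e
  ... | yes _   = s≤s z≤n
  ... | no e≢e = ⊥-elim (e≢e refl)

  circulationThrough : StronglyConnected M S D → ∀ e →
    Σ (Fin n → ℕ) λ w → Circulation w × (S e ≡ true → 1 ≤ w e)
  circulationThrough sc e with S e in Se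
  ... | false = (λ _ → 0) , kernel-zero oriented , λ ()
  ... | true  = (λ f → δ e f +ℕ z f) , isCirculation , λ _ → ℕ.≤-trans (δ-diag e) (ℕ.m≤m+n _ _)
    where
    z = proj₁ (sc e Se)

    isCirculation : Circulation (λ f → δ e f +ℕ z f)
    isCirculation i = trans (∑-cong (λ f → restrict (S f))) (proj₂ (proj₂ (sc e Se)) i)
      where
      restrict : ∀ {f} (b : Bool) →
        (if b then signℤ (D f) else + 0) * M i f * + (δ e f +ℕ z f) ≡
        (if b then signℤ (D f) * M i f * + (δ e f +ℕ z f) else + 0)
      restrict true  = refl
      restrict false = refl

  positiveCirculation : StronglyConnected M S D →
    Σ (Fin n → ℕ) λ x → Circulation x × (∀ f → S f ≡ true → 1 ≤ x f)
  positiveCirculation sc = x , x-circulation , x>0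
    where
    w : Fin n → Fin n → ℕ
    w e = proj₁ (circulationThrough sc e)

    x : Fin n → ℕ
    x f = sumℕ (λ e → w e f)

    x-circulation : Circulation x
    x-circulation i =
      trans (∑-cong (λ f → cong (oriented i f *_) (+-sumℕ (λ e → w e f))))
      (kernel-∑ oriented (λ e f → + w e f) (λ e → proj₁ (proj₂ (circulationThrough sc e))) i)

    x>0 : ∀ f → S f ≡ true → 1 ≤ x f
    x>0 f Sf = ℕ.≤-trans (proj₂ (proj₂ (circulationThrough sc f)) Sf) (≤-sumℕ (λ e → w e f) f)

lemma4p17 : (m n : ℕ) (M : Matrix m n) → TotallyUnimodular M →
    (S : Fin n → Bool) (D : Fin n → Sign) → StronglyConnected M S D →
      Σ (Fin n → ℤ) λ μ → InLattice M μ × IsInducedBy μ S D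
lemma4p17 m n M _ S D sc with positiveCirculation M S D sc
... | x , x-circulation , x>0 =
  (λ f → orientation S D f * + x f) ,
  kernel-scaleColumns M (orientation S D) (λ f → + x f) x-circulation ,
  orientation-isInducedBy S D x x>0
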